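{- The assignment $\Gamma$, given on objects by $\Gamma(\mathcal M)=\mathscr P(\mathscr T(\mathbf{Lin}(\mathcal M)))$ and on morphisms by $\Gamma(k)(A)=\{k\circ a\circ k^{ -1}:a\in A\}$, is a functor from the category $\mathbb{COL}$ of complete orthomodular lattices and ortholattice isomorphisms to the category $\mathscr T\mathbb{ODA}$ of $\mathscr T$-based orthomodular dynamic algebras.
   Context: A unital involutive quantale $(K,\bigsqcup,\odot,{}^*,e)$: complete join-semilattice (binary join $\sqcup$), associative $\odot$ distributing over arbitrary joins on both sides, unit $e$, involution with $x^{**}=x$, $(x\odot y)^*=y^*\odot x^*$, $(\bigsqcup x_i)^*=\bigsqcup x_i^*$. An involutive generalized dynamic algebra (IDA) is $(K,\bigsqcup,\odot,{}^*,{\sim},e)$ with such a quantale and ${\sim}:K\to K$ satisfying for all $x,y$ and families $(x_i)$: ${\sim}(x\odot{\sim}{\sim}y)={\sim}(x\odot y)$; ${\sim}(\bigsqcup_i{\sim}{\sim}x_i)={\sim}(\bigsqcup_ix_i)$; $({\sim}x)^*={\sim}x$; ${\sim}{\sim}({\sim}{\sim}x\odot y)={\sim}({\sim}x\sqcup{\sim}({\sim}x\sqcup y))$. Notation: $\widetilde K=\{{\sim}k\}$; $\bigvee W={\sim}{\sim}\bigsqcup W$; $k\preceq l$ iff $\bigvee\{k,l\}=l$; $w^\perp={\sim}w$; $k\bullet v={\sim}{\sim}(k\odot v)$; $k\equiv l$ iff $k\bullet w=l\bullet w$ for all $w\in\widetilde K$. IDA morphisms preserve arbitrary joins, $\odot$,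 unit, ${}^*$, ${\sim}$. Semi-Foulis: $(\widetilde K,\preceq,{}^\perp)$ is a complete orthomodular lattice (OML). For a complete OML $\mathcal M$ with Sasaki projections $\pi_m(x)=m\wedge(m^\perp\vee x)$, $\mathbf{Lin}(\mathcal M)$ is the set of maps $f:M\to M$ admitting $f^*$ with $f(x)\le y^\perp\iff x\le f^*(y)^\perp$, with pointwise joins, $\odot=\circ$, involution $f^*$, unit $\mathrm{id}_M$, ${\sim}f=\pi_{f(1)^\perp}$ (an IDA). For an involutive submonoid $L\subseteq\mathbf{Lin}(\mathcal M)$ containing all $\pi_m$, $\mathscr P(L)$ is the IDA of subsets of $L$ with union, $A\odot B=\{a\circ b\}$, $A^*=\{a^*\}$, ${\sim}A=\{\pi_{(\bigvee_{a\in A}a(1))^\perp}\}$, unit $\{\mathrm{id}_M\}$. $\mathbb{IM}$: involutive monoids with maps preserving product, unit, involution. Fix a functor $\mathscr T$ from IDAs to $\mathbb{IM}$ with: (T1) $\widetilde K\subseteq\mathscr T(K)\subseteq K$, $\mathscr T(K)$ an involutive submonoid; (T2) for every semi-Foulis $\mathfrak K$ with $s=t\iff s\equiv t$ on $\mathscr T(K)$, $\nu_{\mathfrak K}(k)=k\bullet(-)$ is an $\mathbb{IM}$-isomorphism $\mathscr T(\mathfrak K)\to\mathscr T(\mathbf{Lin}(\widetilde K,\preceq,{}^\perp))$; (T3) for every complete OML $\mathcal M$, $f\mapsto\{f\}$ is an $\mathbb{IM}$-isomorphism $\mathscr T(\mathbf{Lin}(\mathcal M))\to\mathscr T(\mathscr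 P(\mathscr T(\mathbf{Lin}(\mathcal M))))$; (T4) $\mathscr T(f)$ is the restriction of $f$. A $\mathscr T$-based orthomodular dynamic algebra is an IDA with: (TODA1) $(\widetilde K,\preceq,{}^\perp)$ complete OML; (TODA2) any $A$ with $\mathscr T(K)\subseteq A\subseteq K$ closed under $\odot$, ${}^*$, arbitrary joins equals $K$; (TODA3) for $S,T\subseteq\mathscr T(K)$, $\bigsqcup S=\bigsqcup T$ iff $S=T$; (TODA4) for $s,t\in\mathscr T(K)$, $s=t$ iff $s\equiv t$. $\mathscr T\mathbb{ODA}$ has these as objects and bijective IDA morphisms as morphisms. $\mathbb{COL}$ has complete OMLs as objects and ortholattice isomorphisms (bijections $k$ with $m\le n\iff k(m)\le k(n)$ and $k(m^\perp)=k(m)^\perp$) as morphisms. -}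

module Defs where

open import Level using (Level; _⊔_; Lift; lift; lower; Setω) renaming (suc to lsuc)
open import Data.Bool using (Bool; true; false)
open import Data.Empty using (⊥)
open import Data.Product using (Σ; _×_; _,_; proj₁; proj₂)
open import Relation.Binary using (Rel; IsEquivalence; IsPartialOrder)
open import Relation.Unary using (Pred)

-- Two-element families (binary joins / meets as joins / meets of families)

pair : ∀ {a} (ι : Level) {A : Set a} → A → A → Lift ι Bool → A
pair ι x y (lift true)  = x
pair ι x y (lift false) = y

-- Complete orthomodular lattices (order-theoretic, on a setoid).
-- "Complete": suprema and infima of all families indexed by types in Set ι.

record IsCOML {a ℓ} (ι : Level) {A : Set a} (_≈_ : Rel A ℓ) (_≤_ : Rel A ℓ)
              (_ᗮ : A → A) : Set (a ⊔ ℓ ⊔ lsuc ι) where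
  field
    isPartialOrder : IsPartialOrder _≈_ _≤_
    sup        : {I : Set ι} → (I → A) → A
    sup-upper  : ∀ {I : Set ι} (f : I → A) (i : I) → f i ≤ sup f
    sup-least  : ∀ {I : Set ι} (f : I → A) {z : A} → (∀ i → f i ≤ z) → sup f ≤ z
    inf        : {I : Set ι} → (I → A) → A
    inf-lower  : ∀ {I : Set ι} (f : I → A) (i : I) → inf f ≤ f i
    inf-greatest : ∀ {I : Set ι} (f : I → A) {z : A} → (∀ i → z ≤ f i) → z ≤ inf f
    ᗮ-involutive : ∀ x → ((x ᗮ) ᗮ) ≈ x
    ᗮ-antitone   : ∀ {x y} → x ≤ y → (y ᗮ) ≤ (x ᗮ)
    ᗮ-complement : ∀ x y → inf (pair ι x (x ᗮ)) ≤ y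
    orthomodular : ∀ {x y} → x ≤ y → y ≤ sup (pair ι x (inf (pair ι (x ᗮ) y)))

record COML (c ℓ ι : Level) : Set (lsuc (c ⊔ ℓ ⊔ ι)) where
  infix 4 _≈_ _≤_
  field
    Carrier : Set c
    _≈_     : Rel Carrier ℓ
    _≤_     : Rel Carrier ℓ
    _ᗮ      : Carrier → Carrier
    isCOML  : IsCOML ι _≈_ _≤_ _ᗮ
  open IsCOML isCOML public
  open IsPartialOrder isPartialOrder public

  _∨_ : Carrier → Carrier → Carrier
  x ∨ y = sup (pair ι x y)

  _∧_ : Carrier → Carrier → Carrier
  x ∧ y = inf (pair ι x y)

  ⊤ : Carrier
  ⊤ = inf {Lift ι ⊥} (λ ())

  π : Carrier → Carrier → Carrier
  π m x = m ∧ ((m ᗮ) ∨ x)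

module OMLLemmas {c ℓ ι} (M : COML c ℓ ι) where
  open COML M
  module E = IsEquivalence isEquivalence

  ≤-respʳ : ∀ {x y z} → y ≈ z → x ≤ y → x ≤ z
  ≤-respʳ e p = trans p (reflexive e)

  ≤-respˡ : ∀ {x y z} → x ≈ y → x ≤ z → y ≤ z
  ≤-respˡ e p = trans (reflexive (E.sym e)) p

  swap : ∀ {x y} → x ≤ (y ᗮ) → y ≤ (x ᗮ)
  swap p = ≤-respˡ (ᗮ-involutive _) (ᗮ-antitone p)

  ᗮ-cong : ∀ {x y} → x ≈ y → (x ᗮ) ≈ (y ᗮ)
  ᗮ-cong e = antisym (ᗮ-antitone (reflexive (E.sym e))) (ᗮ-antitone (reflexive e))

  ∨-l : ∀ x y → x ≤ (x ∨ y)
  ∨-l x y = sup-upper (pair ι x y) (lift true)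
  ∨-r : ∀ x y → y ≤ (x ∨ y)
  ∨-r x y = sup-upper (pair ι x y) (lift false)
  ∨-least : ∀ {x y z} → x ≤ z → y ≤ z → (x ∨ y) ≤ z
  ∨-least {x} {y} p q = sup-least (pair ι x y) λ { (lift true) → p ; (lift false) → q }
  ∧-l : ∀ x y → (x ∧ y) ≤ x
  ∧-l x y = inf-lower (pair ι x y) (lift true)
  ∧-r : ∀ x y → (x ∧ y) ≤ y
  ∧-r x y = inf-lower (pair ι x y) (lift false)
  ∧-greatest : ∀ {x y z} → z ≤ x → z ≤ y → z ≤ (x ∧ y)
  ∧-greatest {x} {y} p q = inf-greatest (pair ι x y) λ { (lift true) → p ; (lift false) → q }

  ∨-mono : ∀ {x x' y y'} → x ≤ x' → y ≤ y' → (x ∨ y) ≤ (x' ∨ y')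
  ∨-mono p q = ∨-least (trans p (∨-l _ _)) (trans q (∨-r _ _))
  ∧-mono : ∀ {x x' y y'} → x ≤ x' → y ≤ y' → (x ∧ y) ≤ (x' ∧ y')
  ∧-mono p q = ∧-greatest (trans (∧-l _ _) p) (trans (∧-r _ _) q)

  sup-mono : ∀ {I : Set ι} {f g : I → Carrier} → (∀ i → f i ≤ g i) → sup f ≤ sup g
  sup-mono {f = f} {g} p = sup-least f λ i → trans (p i) (sup-upper g i)

  sup-cong : ∀ {I : Set ι} {f g : I → Carrier} → (∀ i → f i ≈ g i) → sup f ≈ sup g
  sup-cong p = antisym (sup-mono λ i → reflexive (p i)) (sup-mono λ i → reflexive (E.sym (p i)))

  π-mono : ∀ m {x y} → x ≤ y → π m x ≤ π m y
  π-mono m p = ∧-mono refl (∨-mono refl p)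

  π-cong : ∀ m {x y} → x ≈ y → π m x ≈ π m y
  π-cong m e = antisym (π-mono m (reflexive e)) (π-mono m (reflexive (E.sym e)))

  sasaki : ∀ m x z → π m x ≤ z → x ≤ ((m ᗮ) ∨ (m ∧ z))
  sasaki m x z p =
    trans (∨-r (m ᗮ) x)
      (trans (orthomodular (∨-l (m ᗮ) x))
        (∨-mono refl
          (∧-greatest (trans (∧-mono (reflexive (ᗮ-involutive m)) refl) (∧-l m _))
                      (trans (∧-mono (reflexive (ᗮ-involutive m)) refl) p))))

  π-adj₁ : ∀ m x y → π m x ≤ (y ᗮ) → x ≤ (π m y ᗮ)
  π-adj₁ m x y p = trans (sasaki m x (y ᗮ) p) (∨-least h₁ h₂)
    where
      h₁ : (m ᗮ) ≤ (π m y ᗮ)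
      h₁ = ᗮ-antitone (∧-l m _)
      h₂ : (m ∧ (y ᗮ)) ≤ (π m y ᗮ)
      h₂ = swap (trans (∧-r m _)
                  (∨-least (ᗮ-antitone (∧-l m _)) (swap (∧-r m _))))

  π-adj₂ : ∀ m x y → x ≤ (π m y ᗮ) → π m x ≤ (y ᗮ)
  π-adj₂ m x y p = swap (π-adj₁ m y x (swap p))

record LinMap {c ℓ ι} (M : COML c ℓ ι) : Set (c ⊔ ℓ) where
  open COML M
  field
    fun      : Carrier → Carrier
    adj      : Carrier → Carrier
    fun-cong : ∀ {x y} → x ≈ y → fun x ≈ fun y
    adj-cong : ∀ {x y} → x ≈ y → adj x ≈ adj y
    adjoint  : ∀ x y → (fun x ≤ (y ᗮ) → x ≤ (adj y ᗮ)) × (x ≤ (adj y ᗮ) → fun x ≤ (y ᗮ))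
open LinMap public

record PreIDA (c ℓ ι : Level) : Set (lsuc (c ⊔ ℓ ⊔ ι)) where
  infix 4 _≈_
  field
    Carrier       : Set c
    _≈_           : Rel Carrier ℓ
    isEquivalence : IsEquivalence _≈_
    ⨆             : {I : Set ι} → (I → Carrier) → Carrier
    _⊙_           : Carrier → Carrier → Carrier
    _*            : Carrier → Carrier
    ∼             : Carrier → Carrier
    e             : Carrier

  _⊔'_ : Carrier → Carrier → Carrier
  x ⊔' y = ⨆ (pair ι x y)

  _≤_ : Rel Carrier ℓ
  x ≤ y = (x ⊔' y) ≈ y

  IsTilde : Carrier → Set (c ⊔ ℓ)
  IsTilde k = Σ Carrier λ l → k ≈ ∼ l

  Tilde : Set (c ⊔ ℓ)
  Tilde = Σ Carrier IsTilde

  -- k ⪯ l  iff  ⋁{k,l} = ∼∼⨆{k,l} = l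
  _⪯_ : Rel Carrier ℓ
  k ⪯ l = ∼ (∼ (k ⊔' l)) ≈ l

  _•_ : Carrier → Carrier → Carrier
  k • v = ∼ (∼ (k ⊙ v))

  _≡ᵏ_ : Rel Carrier (c ⊔ ℓ)
  k ≡ᵏ l = ∀ w → IsTilde w → (k • w) ≈ (l • w)

  _≈ᵗ_ : Rel Tilde ℓ
  x ≈ᵗ y = proj₁ x ≈ proj₁ y

  _⪯ᵗ_ : Rel Tilde ℓ
  x ⪯ᵗ y = proj₁ x ⪯ proj₁ y

  _ᗮᵗ : Tilde → Tilde
  (k , _) ᗮᵗ = ∼ k , k , IsEquivalence.refl isEquivalence

record IsIDA {c ℓ ι} (K : PreIDA c ℓ ι) : Set (c ⊔ ℓ ⊔ lsuc ι) where
  open PreIDA K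
  field
    isPartialOrder : IsPartialOrder _≈_ _≤_
    ⨆-upper : ∀ {I : Set ι} (f : I → Carrier) (i : I) → f i ≤ ⨆ f
    ⨆-least : ∀ {I : Set ι} (f : I → Carrier) {z} → (∀ i → f i ≤ z) → ⨆ f ≤ z
    ⊙-cong      : ∀ {x x' y y'} → x ≈ x' → y ≈ y' → (x ⊙ y) ≈ (x' ⊙ y')
    ⊙-assoc     : ∀ x y z → ((x ⊙ y) ⊙ z) ≈ (x ⊙ (y ⊙ z))
    ⊙-identityˡ : ∀ x → (e ⊙ x) ≈ x
    ⊙-identityʳ : ∀ x → (x ⊙ e) ≈ x
    ⊙-distribˡ  : ∀ x {I : Set ι} (f : I → Carrier) → (x ⊙ ⨆ f) ≈ ⨆ (λ i → x ⊙ f i)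
    ⊙-distribʳ  : ∀ x {I : Set ι} (f : I → Carrier) → (⨆ f ⊙ x) ≈ ⨆ (λ i → f i ⊙ x)
    *-cong      : ∀ {x y} → x ≈ y → (x *) ≈ (y *)
    *-involutive : ∀ x → ((x *) *) ≈ x
    *-anti      : ∀ x y → ((x ⊙ y) *) ≈ ((y *) ⊙ (x *))
    *-⨆         : ∀ {I : Set ι} (f : I → Carrier) → (⨆ f *) ≈ ⨆ (λ i → f i *)
    ∼-cong : ∀ {x y} → x ≈ y → ∼ x ≈ ∼ y
    ida₁ : ∀ x y → ∼ (x ⊙ ∼ (∼ y)) ≈ ∼ (x ⊙ y)
    ida₂ : ∀ {I : Set ι} (f : I → Carrier) → ∼ (⨆ (λ i → ∼ (∼ (f i)))) ≈ ∼ (⨆ f)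
    ida₃ : ∀ x → (∼ x *) ≈ ∼ x
    ida₄ : ∀ x y → ∼ (∼ (∼ (∼ x) ⊙ y)) ≈ ∼ (∼ x ⊔' ∼ (∼ x ⊔' y))

SemiFoulis : ∀ {c ℓ ι} → PreIDA c ℓ ι → Set (c ⊔ ℓ ⊔ lsuc ι)
SemiFoulis {ι = ι} K = IsCOML ι _≈ᵗ_ _⪯ᵗ_ _ᗮᵗ
  where open PreIDA K

tildeCOML : ∀ {c ℓ ι} (K : PreIDA c ℓ ι) → SemiFoulis K → COML (c ⊔ ℓ) ℓ ι
tildeCOML K sf = record
  { Carrier = Tilde ; _≈_ = _≈ᵗ_ ; _≤_ = _⪯ᵗ_ ; _ᗮ = _ᗮᵗ ; isCOML = sf }
  where open PreIDA K

record IsIDAMorphism {c ℓ c' ℓ' ι} (K : PreIDA c ℓ ι) (L : PreIDA c' ℓ' ι)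
         (f : PreIDA.Carrier K → PreIDA.Carrier L) : Set (c ⊔ ℓ ⊔ ℓ' ⊔ lsuc ι) where
  private
    module K = PreIDA K
    module L = PreIDA L
  field
    cong  : ∀ {x y} → x K.≈ y → f x L.≈ f y
    ⨆-hom : ∀ {I : Set ι} (g : I → K.Carrier) → f (K.⨆ g) L.≈ L.⨆ (λ i → f (g i))
    ⊙-hom : ∀ x y → f (x K.⊙ y) L.≈ (f x L.⊙ f y)
    e-hom : f K.e L.≈ L.e
    *-hom : ∀ x → f (x K.*) L.≈ (f x L.*)
    ∼-hom : ∀ x → f (K.∼ x) L.≈ L.∼ (f x)

record Bijective {c ℓ c' ℓ' ι} (K : PreIDA c ℓ ι) (L : PreIDA c' ℓ' ι)
         (f : PreIDA.Carrier K → PreIDA.Carrier L) : Set (c ⊔ ℓ ⊔ c' ⊔ ℓ') where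
  private
    module K = PreIDA K
    module L = PreIDA L
  field
    injective  : ∀ x y → f x L.≈ f y → x K.≈ y
    surjective : ∀ y → Σ K.Carrier λ x → f x L.≈ y

-- Isomorphisms of involutive monoids between submonoids P ⊆ K, Q ⊆ L
-- (the product, unit and involution are those of K and L).
record IsIMIso {c ℓ ι c' ℓ' ι' p q} (K : PreIDA c ℓ ι) (L : PreIDA c' ℓ' ι')
         (P : Pred (PreIDA.Carrier K) p) (Q : Pred (PreIDA.Carrier L) q)
         (φ : Σ (PreIDA.Carrier K) P → Σ (PreIDA.Carrier L) Q)
         : Set (c ⊔ ℓ ⊔ c' ⊔ ℓ' ⊔ p ⊔ q) where
  private
    module K = PreIDA K
    module L = PreIDA L
  field
    cong  : ∀ x y → proj₁ x K.≈ proj₁ y → proj₁ (φ x) L.≈ proj₁ (φ y)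
    ⊙-hom : ∀ x y (pxy : P (proj₁ x K.⊙ proj₁ y)) →
              proj₁ (φ (_ , pxy)) L.≈ (proj₁ (φ x) L.⊙ proj₁ (φ y))
    e-hom : ∀ (pe : P K.e) → proj₁ (φ (K.e , pe)) L.≈ L.e
    *-hom : ∀ x (px : P (proj₁ x K.*)) → proj₁ (φ (_ , px)) L.≈ (proj₁ (φ x) L.*)
    injective  : ∀ x y → proj₁ (φ x) L.≈ proj₁ (φ y) → proj₁ x K.≈ proj₁ y
    surjective : ∀ (y : Σ L.Carrier Q) → Σ (Σ K.Carrier P) λ x → proj₁ (φ x) L.≈ proj₁ y

module _ {c ℓ ι} (M : COML c ℓ ι) where
  open COML M
  open OMLLemmas M

  private
    idL : LinMap M
    idL = record { fun = λ x → x ; adj = λ x → x ; fun-cong = λ e → e ; adj-cong = λ e → e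
                 ; adjoint = λ x y → (λ p → p) , (λ p → p) }

    compL : LinMap M → LinMap M → LinMap M
    compL f g = record
      { fun = λ x → fun f (fun g x) ; adj = λ y → adj g (adj f y)
      ; fun-cong = λ e → fun-cong f (fun-cong g e)
      ; adj-cong = λ e → adj-cong g (adj-cong f e)
      ; adjoint = λ x y →
          (λ p → proj₁ (adjoint g x (adj f y)) (proj₁ (adjoint f (fun g x) y) p))
        , (λ p → proj₂ (adjoint f (fun g x) y) (proj₂ (adjoint g x (adj f y)) p)) }

    starL : LinMap M → LinMap M
    starL f = record
      { fun = adj f ; adj = fun f ; fun-cong = adj-cong f ; adj-cong = fun-cong f
      ; adjoint = λ x y →
          (λ p → swap (proj₂ (adjoint f y x) (swap p)))
        , (λ p → swap (proj₁ (adjoint f y x) (swap p))) }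

    supL : {I : Set ι} → (I → LinMap M) → LinMap M
    supL F = record
      { fun = λ x → sup (λ i → fun (F i) x)
      ; adj = λ y → sup (λ i → adj (F i) y)
      ; fun-cong = λ e → sup-cong (λ i → fun-cong (F i) e)
      ; adj-cong = λ e → sup-cong (λ i → adj-cong (F i) e)
      ; adjoint = λ x y →
          (λ p → swap (sup-least _ λ i →
                   swap (proj₁ (adjoint (F i) x y) (trans (sup-upper _ i) p))))
        , (λ p → sup-least _ λ i →
                   proj₂ (adjoint (F i) x y) (swap (trans (sup-upper _ i) (swap p)))) }

    πL : Carrier → LinMap M
    πL m = record
      { fun = π m ; adj = π m ; fun-cong = π-cong m ; adj-cong = π-cong m
      ; adjoint = λ x y → π-adj₁ m x y , π-adj₂ m x y }

  Lin : PreIDA (c ⊔ ℓ) (c ⊔ ℓ) ι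
  Lin = record
    { Carrier = LinMap M
    ; _≈_ = λ f g → ∀ x → fun f x ≈ fun g x
    ; isEquivalence = record
        { refl = λ x → E.refl ; sym = λ p x → E.sym (p x) ; trans = λ p q x → E.trans (p x) (q x) }
    ; ⨆ = supL
    ; _⊙_ = compL
    ; _* = starL
    ; ∼ = λ f → πL (fun f ⊤ ᗮ)
    ; e = idL
    }

-- 𝒫(L) for L = the submonoid Q ⊆ Lin(M): ≈-closed subsets of L.

module _ {c ℓ ι} (M : COML c ℓ (c ⊔ ℓ ⊔ ι)) (Q : Pred (LinMap M) (c ⊔ ℓ)) where
  open COML M
  private
    ι₀ = c ⊔ ℓ ⊔ ι
    module E = IsEquivalence isEquivalence

  El : Set (c ⊔ ℓ)
  El = Σ (LinMap M) Q

  _≈ᴱ_ : El → El → Set (c ⊔ ℓ)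
  a ≈ᴱ b = ∀ x → fun (proj₁ a) x ≈ fun (proj₁ b) x

  record Sub : Set (lsuc ι₀) where
    field
      mem    : El → Set ι₀
      closed : ∀ {a b} → a ≈ᴱ b → mem a → mem b
  open Sub public

  singleton : LinMap M → Sub
  singleton f = record
    { mem = λ h → Lift ι₀ (∀ x → fun (proj₁ h) x ≈ fun f x)
    ; closed = λ e (lift p) → lift λ x → E.trans (E.sym (e x)) (p x) }

  𝒫 : PreIDA (lsuc ι₀) ι₀ ι₀
  𝒫 = record
    { Carrier = Sub
    ; _≈_ = λ A B → (∀ h → mem A h → mem B h) × (∀ h → mem B h → mem A h)
    ; isEquivalence = record
        { refl = (λ h p → p) , (λ h p → p)
        ; sym = λ (p , q) → q , p
        ; trans = λ (p , q) (p' , q') → (λ h z → p' h (p h z)) , (λ h z → q h (q' h z)) }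
    ; ⨆ = λ {I} F → record
        { mem = λ h → Σ I λ i → mem (F i) h
        ; closed = λ e (i , p) → i , closed (F i) e p }
    ; _⊙_ = λ A B → record
        { mem = λ h → Σ El λ a → Σ El λ b → mem A a × mem B b ×
                       (∀ x → fun (proj₁ h) x ≈ fun (proj₁ a) (fun (proj₁ b) x))
        ; closed = λ e (a , b , pa , pb , q) → a , b , pa , pb , λ x → E.trans (E.sym (e x)) (q x) }
    ; _* = λ A → record
        { mem = λ h → Σ El λ a → mem A a × (∀ x → fun (proj₁ h) x ≈ adj (proj₁ a) x)
        ; closed = λ e (a , pa , q) → a , pa , λ x → E.trans (E.sym (e x)) (q x) }
    ; ∼ = λ A → record
        { mem = λ h → Lift ι₀ (∀ x → fun (proj₁ h) x ≈
                   π (sup {Σ El (mem A)} (λ a → fun (proj₁ (proj₁ a)) ⊤) ᗮ) x)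
        ; closed = λ e (lift q) → lift λ x → E.trans (E.sym (e x)) (q x) }
    ; e = record
        { mem = λ h → Lift ι₀ (∀ x → fun (proj₁ h) x ≈ x)
        ; closed = λ e (lift q) → lift λ x → E.trans (E.sym (e x)) (q x) }
    }

-- The functor 𝒯 : IDA → IM, given by subsets 𝒯(K) ⊆ K (T1, T4),
-- functorial (IDA morphisms map 𝒯(K) into 𝒯(L)), and satisfying T2, T3.

record TFunctor : Setω where
  field
    𝒯 : ∀ {c ℓ ι} (K : PreIDA c ℓ ι) → Pred (PreIDA.Carrier K) (c ⊔ ℓ)
    𝒯-resp  : ∀ {c ℓ ι} (K : PreIDA c ℓ ι) → IsIDA K →
                ∀ {x y} → PreIDA._≈_ K x y → 𝒯 K x → 𝒯 K y
    𝒯-tilde : ∀ {c ℓ ι} (K : PreIDA c ℓ ι) → IsIDA K →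
                ∀ k → 𝒯 K (PreIDA.∼ K k)
    𝒯-⊙     : ∀ {c ℓ ι} (K : PreIDA c ℓ ι) → IsIDA K →
                ∀ {x y} → 𝒯 K x → 𝒯 K y → 𝒯 K (PreIDA._⊙_ K x y)
    𝒯-*     : ∀ {c ℓ ι} (K : PreIDA c ℓ ι) → IsIDA K →
                ∀ {x} → 𝒯 K x → 𝒯 K (PreIDA._* K x)
    𝒯-e     : ∀ {c ℓ ι} (K : PreIDA c ℓ ι) → IsIDA K → 𝒯 K (PreIDA.e K)
    -- functoriality (with T4: 𝒯(f) is the restriction of f)
    𝒯-map : ∀ {c ℓ c' ℓ' ι} (K : PreIDA c ℓ ι) (L : PreIDA c' ℓ' ι) →
              IsIDA K → IsIDA L →
              (f : PreIDA.Carrier K → PreIDA.Carrier L) → IsIDAMorphism K L f →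
              ∀ k → 𝒯 K k → 𝒯 L (f k)
    T2 : ∀ {c ℓ ι} (K : PreIDA c ℓ ι) → IsIDA K → (sf : SemiFoulis K) →
           (∀ s t → 𝒯 K s → 𝒯 K t →
              (PreIDA._≈_ K s t → PreIDA._≡ᵏ_ K s t) × (PreIDA._≡ᵏ_ K s t → PreIDA._≈_ K s t)) →
           Σ (Σ (PreIDA.Carrier K) (𝒯 K) → Σ (LinMap (tildeCOML K sf)) (𝒯 (Lin (tildeCOML K sf))))
             λ ν → (∀ k w → PreIDA._≈_ K (proj₁ (fun (proj₁ (ν k)) w))
                                         (PreIDA._•_ K (proj₁ k) (proj₁ w)))
                 × IsIMIso K (Lin (tildeCOML K sf)) (𝒯 K) (𝒯 (Lin (tildeCOML K sf))) ν
    T3 : ∀ {c ℓ ι} (M : COML c ℓ (c ⊔ ℓ ⊔ ι)) →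
           Σ (Σ (LinMap M) (𝒯 (Lin M)) → Σ (Sub M (𝒯 (Lin M))) (𝒯 (𝒫 {ι = ι} M (𝒯 (Lin M)))))
             λ σ → (∀ f → PreIDA._≈_ (𝒫 {ι = ι} M (𝒯 (Lin M)))
                                      (proj₁ (σ f)) (singleton {ι = ι} M (𝒯 (Lin M)) (proj₁ f)))
                 × IsIMIso (Lin M) (𝒫 {ι = ι} M (𝒯 (Lin M))) (𝒯 (Lin M))
                           (𝒯 (𝒫 {ι = ι} M (𝒯 (Lin M)))) σ
open TFunctor public

record IsTODA (T : TFunctor) {c ℓ ι} (K : PreIDA c ℓ ι) : Set (lsuc (c ⊔ ℓ ⊔ ι)) where
  open PreIDA K
  field
    isIDA : IsIDA K
    toda1 : SemiFoulis K
    toda2 : ∀ (A : Pred Carrier (c ⊔ ℓ ⊔ ι)) →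
              (∀ {x y} → x ≈ y → A x → A y) →
              (∀ k → 𝒯 T K k → A k) →
              (∀ {x y} → A x → A y → A (x ⊙ y)) →
              (∀ {x} → A x → A (x *)) →
              (∀ {I : Set ι} (f : I → Carrier) → (∀ i → A (f i)) → A (⨆ f)) →
              ∀ k → A k
    toda3 : ∀ {I J : Set ι} (s : I → Carrier) (t : J → Carrier) →
              (∀ i → 𝒯 T K (s i)) → (∀ j → 𝒯 T K (t j)) →
              (⨆ s ≈ ⨆ t →
                 (∀ i → Σ J λ j → s i ≈ t j) × (∀ j → Σ I λ i → t j ≈ s i))
            × ((∀ i → Σ J λ j → s i ≈ t j) × (∀ j → Σ I λ i → t j ≈ s i) →
                 ⨆ s ≈ ⨆ t)
    toda4 : ∀ s t → 𝒯 T K s → 𝒯 T K t → (s ≈ t → s ≡ᵏ t) × (s ≡ᵏ t → s ≈ t)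

record OIso {c ℓ ι} (M N : COML c ℓ ι) : Set (c ⊔ ℓ) where
  private
    module M = COML M
    module N = COML N
  field
    to   : M.Carrier → N.Carrier
    from : N.Carrier → M.Carrier
    to-cong   : ∀ {x y} → x M.≈ y → to x N.≈ to y
    from-cong : ∀ {x y} → x N.≈ y → from x M.≈ from y
    to-from   : ∀ y → to (from y) N.≈ y
    from-to   : ∀ x → from (to x) M.≈ x
    to-mono    : ∀ {x y} → x M.≤ y → to x N.≤ to y
    to-reflect : ∀ {x y} → to x N.≤ to y → x M.≤ y
    to-ᗮ       : ∀ x → to (x M.ᗮ) N.≈ (to x N.ᗮ)
open OIso public

idOIso : ∀ {c ℓ ι} (M : COML c ℓ ι) → OIso M M
idOIso M = record
  { to = λ x → x ; from = λ x → x ; to-cong = λ e → e ; from-cong = λ e → e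
  ; to-from = λ _ → E.refl ; from-to = λ _ → E.refl
  ; to-mono = λ p → p ; to-reflect = λ p → p ; to-ᗮ = λ _ → E.refl }
  where open COML M
        module E = IsEquivalence isEquivalence

_∘ᴼ_ : ∀ {c ℓ ι} {M N O : COML c ℓ ι} → OIso N O → OIso M N → OIso M O
_∘ᴼ_ {M = M} {O = O} k' k = record
  { to = λ x → to k' (to k x) ; from = λ z → from k (from k' z)
  ; to-cong = λ e → to-cong k' (to-cong k e)
  ; from-cong = λ e → from-cong k (from-cong k' e)
  ; to-from = λ z → E.trans (to-cong k' (to-from k (from k' z))) (to-from k' z)
  ; from-to = λ x → IsEquivalence.trans (COML.isEquivalence M)
                      (from-cong k (from-to k' (to k x))) (from-to k x)
  ; to-mono = λ p → to-mono k' (to-mono k p)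
  ; to-reflect = λ p → to-reflect k (to-reflect k' p)
  ; to-ᗮ = λ x → E.trans (to-cong k' (to-ᗮ k x)) (to-ᗮ k' (to k x)) }
  where module E = IsEquivalence (COML.isEquivalence O)

Γ₀ : (T : TFunctor) {c ℓ ι : Level} → COML c ℓ (c ⊔ ℓ ⊔ ι) →
     PreIDA (lsuc (c ⊔ ℓ ⊔ ι)) (c ⊔ ℓ ⊔ ι) (c ⊔ ℓ ⊔ ι)
Γ₀ T {ι = ι} M = 𝒫 {ι = ι} M (𝒯 T (Lin M))

Γ₁ : (T : TFunctor) {c ℓ ι : Level} {M N : COML c ℓ (c ⊔ ℓ ⊔ ι)} → OIso M N →
     PreIDA.Carrier (Γ₀ T {ι = ι} M) → PreIDA.Carrier (Γ₀ T {ι = ι} N)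
Γ₁ T {c} {ℓ} {ι} {M} {N} k A = record
  { mem = λ h → Σ (El {ι = ι} M (𝒯 T (Lin M))) λ a → mem A a ×
                  (∀ x → fun (proj₁ h) x N.≈ to k (fun (proj₁ a) (from k x)))
  ; closed = λ e (a , pa , q) → a , pa , λ x → E.trans (E.sym (e x)) (q x) }
  where module N = COML N
        module E = IsEquivalence N.isEquivalence

module Submission where

-- Write image A = ⋁_{a ∈ A} a ⊤ for a set A of linear maps.  Then ∼ A = ｛ π_{(image A)ᗮ} ｝, so
-- image is an ortho-isomorphism from the ∼-elements of 𝒫(𝒯(Lin M)) onto M and the algebra is
-- semi-Foulis.  By T3 the 𝒯-elements are exactly the singletons ｛ f ｝: every set is the union
-- of its singletons, a union of singletons determines them, and ｛ f ｝ is determined by its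
-- action on ∼-elements because f x = image (｛ f ｝ • ｛ π x ｝).  Conjugation a ↦ k ∘ a ∘ k⁻¹ by
-- an ortholattice isomorphism preserves composition, adjoints, joins and Sasaki projections, so
-- Γ(k) is a bijective IDA morphism; the functor laws hold elementwise.

open import Defs
open import Level using (Level; _⊔_; Lift; lift; lower) renaming (suc to lsuc)
open import Data.Bool using (Bool; true; false)
open import Function using (_∘_)
open import Data.Product using (Σ; _×_; _,_; proj₁; proj₂)
open import Relation.Binary using (Rel; Setoid; IsEquivalence; IsPartialOrder)
import Relation.Binary.Reasoning.Setoid as SetoidReasoning

module OMLProperties {c ℓ ι} (M : COML c ℓ ι) where
  open COML M
  open OMLLemmas M public

  setoid : Setoid c ℓ
  setoid = record { isEquivalence = isEquivalence }

  ∧-cong : ∀ {x x' y y'} → x ≈ x' → y ≈ y' → (x ∧ y) ≈ (x' ∧ y')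
  ∧-cong p q = antisym (∧-mono (reflexive p) (reflexive q))
                       (∧-mono (reflexive (E.sym p)) (reflexive (E.sym q)))

  ∨-cong : ∀ {x x' y y'} → x ≈ x' → y ≈ y' → (x ∨ y) ≈ (x' ∨ y')
  ∨-cong p q = antisym (∨-mono (reflexive p) (reflexive q))
                       (∨-mono (reflexive (E.sym p)) (reflexive (E.sym q)))

  inf-mono : ∀ {I : Set ι} {f g : I → Carrier} → (∀ i → f i ≤ g i) → inf f ≤ inf g
  inf-mono {f = f} {g} p = inf-greatest g λ i → trans (inf-lower f i) (p i)

  inf-cong : ∀ {I : Set ι} {f g : I → Carrier} → (∀ i → f i ≈ g i) → inf f ≈ inf g
  inf-cong p = antisym (inf-mono λ i → reflexive (p i)) (inf-mono λ i → reflexive (E.sym (p i)))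

  sup-pair : ∀ {x y} (h : Lift ι Bool → Carrier) →
             h (lift true) ≈ x → h (lift false) ≈ y → sup h ≈ (x ∨ y)
  sup-pair h p q = sup-cong λ { (lift true) → p ; (lift false) → q }

  inf-pair : ∀ {x y} (h : Lift ι Bool → Carrier) →
             h (lift true) ≈ x → h (lift false) ≈ y → inf h ≈ (x ∧ y)
  inf-pair h p q = inf-cong λ { (lift true) → p ; (lift false) → q }

  x≤⊤ : ∀ x → x ≤ ⊤
  x≤⊤ x = inf-greatest _ λ ()

  ᗮ-reflect : ∀ {x y} → (x ᗮ) ≤ (y ᗮ) → y ≤ x
  ᗮ-reflect p = ≤-respʳ (ᗮ-involutive _) (≤-respˡ (ᗮ-involutive _) (ᗮ-antitone p))

  ᗮ-∨ : ∀ x y → ((x ∨ y) ᗮ) ≈ ((x ᗮ) ∧ (y ᗮ))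
  ᗮ-∨ x y = antisym (∧-greatest (ᗮ-antitone (∨-l x y)) (ᗮ-antitone (∨-r x y)))
                    (swap (∨-least (swap (∧-l _ _)) (swap (∧-r _ _))))

  π-congˡ : ∀ {m m'} x → m ≈ m' → π m x ≈ π m' x
  π-congˡ x p = ∧-cong p (∨-cong (ᗮ-cong p) E.refl)

  π-⊤ : ∀ m → π m ⊤ ≈ m
  π-⊤ m = antisym (∧-l _ _) (∧-greatest refl (trans (x≤⊤ m) (∨-r _ _)))

  [πmᗮ⊤]ᗮ≈m : ∀ m → (π (m ᗮ) ⊤ ᗮ) ≈ m
  [πmᗮ⊤]ᗮ≈m m = E.trans (ᗮ-cong (π-⊤ _)) (ᗮ-involutive m)

  [mᗮ∨[mᗮ∨n]ᗮ]ᗮ≈πmn : ∀ m n → (((m ᗮ) ∨ (((m ᗮ) ∨ n) ᗮ)) ᗮ) ≈ π m n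
  [mᗮ∨[mᗮ∨n]ᗮ]ᗮ≈πmn m n = E.trans (ᗮ-∨ _ _) (∧-cong (ᗮ-involutive m) (ᗮ-involutive _))

module LinMapProperties {c ℓ ι} (M : COML c ℓ ι) where
  open COML M
  open OMLProperties M

  private
    fun-le : (f : LinMap M) → ∀ {x z} → x ≤ (adj f (z ᗮ) ᗮ) → fun f x ≤ z
    fun-le f {x} {z} p = ≤-respʳ (ᗮ-involutive z) (proj₂ (adjoint f x (z ᗮ)) p)

    le-adj : (f : LinMap M) → ∀ {x z} → fun f x ≤ z → x ≤ (adj f (z ᗮ) ᗮ)
    le-adj f {x} {z} p = proj₁ (adjoint f x (z ᗮ)) (≤-respʳ (E.sym (ᗮ-involutive z)) p)

  fun-mono : (f : LinMap M) → ∀ {x y} → x ≤ y → fun f x ≤ fun f y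
  fun-mono f p = fun-le f (trans p (le-adj f refl))

  fun-sup : (f : LinMap M) {I : Set ι} (g : I → Carrier) →
            fun f (sup g) ≈ sup (λ i → fun f (g i))
  fun-sup f g = antisym
    (fun-le f (sup-least g λ i → le-adj f (sup-upper (λ i → fun f (g i)) i)))
    (sup-least _ λ i → fun-mono f (sup-upper g i))

  adj-unique : (f g : LinMap M) → (∀ x → fun f x ≈ fun g x) → ∀ y → adj f y ≈ adj g y
  adj-unique f g f≈g y = antisym (adj-≤ g f λ x → E.sym (f≈g x)) (adj-≤ f g f≈g)
    where
      adj-≤ : ∀ f g → (∀ x → fun f x ≈ fun g x) → adj g y ≤ adj f y
      adj-≤ f g f≈g = ᗮ-reflect (proj₁ (adjoint g (adj f y ᗮ) y)
                        (≤-respˡ (f≈g _) (proj₂ (adjoint f (adj f y ᗮ) y) refl)))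

  sasakiMap : Carrier → LinMap M
  sasakiMap m = record
    { fun = π m ; adj = π m ; fun-cong = π-cong m ; adj-cong = π-cong m
    ; adjoint = λ x y → π-adj₁ m x y , π-adj₂ m x y }

module LinIsIDA {c ℓ ι} (M : COML c ℓ ι) where
  open COML M
  open OMLProperties M
  open LinMapProperties M
  module L = PreIDA (Lin M)
  open SetoidReasoning setoid

  ≤⇒pointwise : ∀ {f g} → f L.≤ g → ∀ x → fun f x ≤ fun g x
  ≤⇒pointwise {f} {g} p x = ≤-respʳ (p x) (sup-upper (λ i → fun (pair ι f g i) x) (lift true))

  pointwise⇒≤ : ∀ {f g} → (∀ x → fun f x ≤ fun g x) → f L.≤ g
  pointwise⇒≤ {f} {g} p x = antisym (sup-least _ λ { (lift true) → p x ; (lift false) → refl })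
                                    (sup-upper (λ i → fun (pair ι f g i) x) (lift false))

  ∼-⊤ : ∀ f → fun (L.∼ f) ⊤ ≈ (fun f ⊤ ᗮ)
  ∼-⊤ f = π-⊤ _

  ⊔-pointwise : ∀ f g x → fun (f L.⊔' g) x ≈ (fun f x ∨ fun g x)
  ⊔-pointwise f g x = sup-pair (λ i → fun (pair ι f g i) x) E.refl E.refl

  ∼∼-⊤ : ∀ f → fun (L.∼ (L.∼ f)) ⊤ ≈ fun f ⊤
  ∼∼-⊤ f = E.trans (π-⊤ _) ([πmᗮ⊤]ᗮ≈m _)

  ida₄-⊤ : ∀ f g → (fun (L.∼ (L.∼ (L.∼ f) L.⊙ g)) ⊤ ᗮ)
                   ≈ (fun (L.∼ f L.⊔' L.∼ (L.∼ f L.⊔' g)) ⊤ ᗮ)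
  ida₄-⊤ f g = begin
    fun (L.∼ (L.∼ (L.∼ f) L.⊙ g)) ⊤ ᗮ                ≈⟨ [πmᗮ⊤]ᗮ≈m _ ⟩
    π (fun (L.∼ f) ⊤ ᗮ) (fun g ⊤)                    ≈⟨ π-congˡ _ ([πmᗮ⊤]ᗮ≈m _) ⟩
    π (fun f ⊤) (fun g ⊤)                            ≈⟨ [mᗮ∨[mᗮ∨n]ᗮ]ᗮ≈πmn _ _ ⟨
    ((fun f ⊤ ᗮ) ∨ (((fun f ⊤ ᗮ) ∨ fun g ⊤) ᗮ)) ᗮ    ≈⟨ ᗮ-cong (∨-cong (∼-⊤ f) (ᗮ-cong ∼f⊔g-⊤)) ⟨
    ((fun (L.∼ f) ⊤) ∨ (fun (L.∼ f L.⊔' g) ⊤ ᗮ)) ᗮ   ≈⟨ ᗮ-cong (∨-cong E.refl (∼-⊤ (L.∼ f L.⊔' g))) ⟨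
    ((fun (L.∼ f) ⊤) ∨ fun (L.∼ (L.∼ f L.⊔' g)) ⊤) ᗮ ≈⟨ ᗮ-cong (⊔-pointwise _ _ ⊤) ⟨
    fun (L.∼ f L.⊔' L.∼ (L.∼ f L.⊔' g)) ⊤ ᗮ          ∎
    where
      ∼f⊔g-⊤ : fun (L.∼ f L.⊔' g) ⊤ ≈ ((fun f ⊤ ᗮ) ∨ fun g ⊤)
      ∼f⊔g-⊤ = E.trans (⊔-pointwise _ _ ⊤) (∨-cong (∼-⊤ f) E.refl)

  isIDA : IsIDA (Lin M)
  isIDA = record
    { isPartialOrder = record
        { isPreorder = record
            { isEquivalence = L.isEquivalence
            ; reflexive = λ f≈g → pointwise⇒≤ λ x → reflexive (f≈g x)
            ; trans = λ p q → pointwise⇒≤ λ x → trans (≤⇒pointwise p x) (≤⇒pointwise q x) }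
        ; antisym = λ p q x → antisym (≤⇒pointwise p x) (≤⇒pointwise q x) }
    ; ⨆-upper = λ f i → pointwise⇒≤ λ x → sup-upper _ i
    ; ⨆-least = λ f p → pointwise⇒≤ λ x → sup-least _ λ i → ≤⇒pointwise (p i) x
    ; ⊙-cong = λ {f} p q x → E.trans (fun-cong f (q x)) (p _)
    ; ⊙-assoc = λ _ _ _ _ → E.refl
    ; ⊙-identityˡ = λ _ _ → E.refl
    ; ⊙-identityʳ = λ _ _ → E.refl
    ; ⊙-distribˡ = λ f g _ → fun-sup f _
    ; ⊙-distribʳ = λ _ _ _ → E.refl
    ; *-cong = λ {f} {g} → adj-unique f g
    ; *-involutive = λ _ _ → E.refl
    ; *-anti = λ _ _ _ → E.refl
    ; *-⨆ = λ _ _ → E.refl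
    ; ∼-cong = λ f≈g x → π-congˡ x (ᗮ-cong (f≈g ⊤))
    ; ida₁ = λ f g x → π-congˡ x (ᗮ-cong (fun-cong f (∼∼-⊤ g)))
    ; ida₂ = λ F x → π-congˡ x (ᗮ-cong (sup-cong λ i → ∼∼-⊤ (F i)))
    ; ida₃ = λ _ _ → E.refl
    ; ida₄ = λ f g x → π-congˡ x (ida₄-⊤ f g)
    }

module IDAProperties {c ℓ ι} {K : PreIDA c ℓ ι} (isIDA : IsIDA K) where
  open PreIDA K
  open IsIDA isIDA
  open IsPartialOrder isPartialOrder using (antisym; trans; reflexive)
  private module E = IsEquivalence isEquivalence

  ≈⇒≡ᵏ : ∀ {s t} → s ≈ t → s ≡ᵏ t
  ≈⇒≡ᵏ s≈t w _ = ∼-cong (∼-cong (⊙-cong s≈t E.refl))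

  ⨆-cong-matching : ∀ {I J : Set ι} (s : I → Carrier) (t : J → Carrier) →
                    (∀ i → Σ J λ j → s i ≈ t j) → (∀ j → Σ I λ i → t j ≈ s i) →
                    ⨆ s ≈ ⨆ t
  ⨆-cong-matching s t s⊆t t⊆s = antisym (⨆-≤ s t s⊆t) (⨆-≤ t s t⊆s)
    where
      ⨆-≤ : ∀ {I J : Set ι} (s : I → Carrier) (t : J → Carrier) →
            (∀ i → Σ J λ j → s i ≈ t j) → ⨆ s ≤ ⨆ t
      ⨆-≤ s t s⊆t = ⨆-least s λ i →
        trans (reflexive (proj₂ (s⊆t i))) (⨆-upper t (proj₁ (s⊆t i)))

module TransportCOML {c ℓ ι a ℓ'} (M : COML c ℓ ι) {A : Set a}
  (_≈'_ _≤'_ : Rel A ℓ') (_ᗮ' : A → A)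
  (φ : A → COML.Carrier M) (ψ : COML.Carrier M → A)
  (φψ : ∀ m → COML._≈_ M (φ (ψ m)) m)
  (φ-cong : ∀ {x y} → x ≈' y → COML._≈_ M (φ x) (φ y))
  (φ-injective : ∀ {x y} → COML._≈_ M (φ x) (φ y) → x ≈' y)
  (φ-mono : ∀ {x y} → x ≤' y → COML._≤_ M (φ x) (φ y))
  (φ-reflect : ∀ {x y} → COML._≤_ M (φ x) (φ y) → x ≤' y)
  (φ-ᗮ : ∀ x → COML._≈_ M (φ (x ᗮ')) (COML._ᗮ M (φ x))) where
  open COML M hiding (isCOML)
  open OMLProperties M

  private
    sup' : {I : Set ι} → (I → A) → A
    sup' f = ψ (sup (λ i → φ (f i)))

    inf' : {I : Set ι} → (I → A) → A
    inf' f = ψ (inf (λ i → φ (f i)))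

    φ-inf'-pair : ∀ x y → φ (inf' (pair ι x y)) ≈ (φ x ∧ φ y)
    φ-inf'-pair x y = E.trans (φψ _) (inf-pair (λ i → φ (pair ι x y i)) E.refl E.refl)

    φ-sup'-pair : ∀ x y → φ (sup' (pair ι x y)) ≈ (φ x ∨ φ y)
    φ-sup'-pair x y = E.trans (φψ _) (sup-pair (λ i → φ (pair ι x y i)) E.refl E.refl)

  isCOML : IsCOML ι _≈'_ _≤'_ _ᗮ'
  isCOML = record
    { isPartialOrder = record
       { isPreorder = record
          { isEquivalence = record
              { refl = φ-injective E.refl
              ; sym = λ p → φ-injective (E.sym (φ-cong p))
              ; trans = λ p q → φ-injective (E.trans (φ-cong p) (φ-cong q)) }
          ; reflexive = λ p → φ-reflect (reflexive (φ-cong p))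
          ; trans = λ p q → φ-reflect (trans (φ-mono p) (φ-mono q)) }
       ; antisym = λ p q → φ-injective (antisym (φ-mono p) (φ-mono q)) }
    ; sup = sup'
    ; sup-upper = λ f i → φ-reflect (≤-respʳ (E.sym (φψ _)) (sup-upper (λ i → φ (f i)) i))
    ; sup-least = λ f p → φ-reflect (≤-respˡ (E.sym (φψ _)) (sup-least _ λ i → φ-mono (p i)))
    ; inf = inf'
    ; inf-lower = λ f i → φ-reflect (≤-respˡ (E.sym (φψ _)) (inf-lower (λ i → φ (f i)) i))
    ; inf-greatest = λ f p → φ-reflect (≤-respʳ (E.sym (φψ _)) (inf-greatest _ λ i → φ-mono (p i)))
    ; ᗮ-involutive = λ x → φ-injective (E.trans (φ-ᗮ _) (E.trans (ᗮ-cong (φ-ᗮ x)) (ᗮ-involutive _)))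
    ; ᗮ-antitone = λ p → φ-reflect
        (≤-respˡ (E.sym (φ-ᗮ _)) (≤-respʳ (E.sym (φ-ᗮ _)) (ᗮ-antitone (φ-mono p))))
    ; ᗮ-complement = λ x y → φ-reflect (≤-respˡ
        (E.sym (E.trans (φ-inf'-pair x (x ᗮ')) (∧-cong E.refl (φ-ᗮ x))))
        (ᗮ-complement (φ x) (φ y)))
    ; orthomodular = λ {x} {y} p → φ-reflect (≤-respʳ
        (E.sym (E.trans (φ-sup'-pair _ _)
                        (∨-cong E.refl (E.trans (φ-inf'-pair _ _) (∧-cong (φ-ᗮ x) E.refl)))))
        (orthomodular (φ-mono p)))
    }

module OIsoProperties {c ℓ ι} {M N : COML c ℓ ι} (k : OIso M N) where
  private
    module M = COML M
    module N = COML N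
    module PM = OMLProperties M
    module PN = OMLProperties N

  to≤⇒≤from : ∀ {x y} → to k x N.≤ y → x M.≤ from k y
  to≤⇒≤from p = to-reflect k (PN.≤-respʳ (PN.E.sym (to-from k _)) p)

  ≤from⇒to≤ : ∀ {x y} → x M.≤ from k y → to k x N.≤ y
  ≤from⇒to≤ p = PN.≤-respʳ (to-from k _) (to-mono k p)

  from-mono : ∀ {x y} → x N.≤ y → from k x M.≤ from k y
  from-mono p = to≤⇒≤from (PN.≤-respˡ (PN.E.sym (to-from k _)) p)

  to-injective : ∀ {x y} → to k x N.≈ to k y → x M.≈ y
  to-injective e = M.antisym (to-reflect k (N.reflexive e))
                             (to-reflect k (N.reflexive (PN.E.sym e)))

  from-ᗮ : ∀ x → from k (x N.ᗮ) M.≈ (from k x M.ᗮ)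
  from-ᗮ x = to-injective (PN.E.trans (to-from k _)
    (PN.E.trans (PN.ᗮ-cong (PN.E.sym (to-from k x))) (PN.E.sym (to-ᗮ k (from k x)))))

  inverse : OIso N M
  inverse = record
    { to = from k ; from = to k ; to-cong = from-cong k ; from-cong = to-cong k
    ; to-from = from-to k ; from-to = to-from k ; to-mono = from-mono
    ; to-reflect = λ p → PN.≤-respˡ (to-from k _) (PN.≤-respʳ (to-from k _) (to-mono k p))
    ; to-ᗮ = from-ᗮ }

  to-sup : ∀ {I : Set ι} (f : I → M.Carrier) → to k (M.sup f) N.≈ N.sup (λ i → to k (f i))
  to-sup f = N.antisym
    (≤from⇒to≤ (M.sup-least f λ i → to≤⇒≤from (N.sup-upper (λ i → to k (f i)) i)))
    (N.sup-least _ λ i → to-mono k (M.sup-upper f i))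

  to-inf : ∀ {I : Set ι} (f : I → M.Carrier) → to k (M.inf f) N.≈ N.inf (λ i → to k (f i))
  to-inf f = N.antisym
    (N.inf-greatest _ λ i → to-mono k (M.inf-lower f i))
    (PN.≤-respˡ (to-from k _) (to-mono k (M.inf-greatest f λ i →
      to-reflect k (PN.≤-respˡ (PN.E.sym (to-from k _)) (N.inf-lower (λ i → to k (f i)) i)))))

  to-∨ : ∀ x y → to k (x M.∨ y) N.≈ (to k x N.∨ to k y)
  to-∨ x y = PN.E.trans (to-sup (pair ι x y)) (PN.sup-pair _ PN.E.refl PN.E.refl)

  to-∧ : ∀ x y → to k (x M.∧ y) N.≈ (to k x N.∧ to k y)
  to-∧ x y = PN.E.trans (to-inf (pair ι x y)) (PN.inf-pair _ PN.E.refl PN.E.refl)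

  to-π : ∀ m x → to k (M.π m x) N.≈ N.π (to k m) (to k x)
  to-π m x = PN.E.trans (to-∧ _ _)
    (PN.∧-cong PN.E.refl (PN.E.trans (to-∨ _ _) (PN.∨-cong (to-ᗮ k m) PN.E.refl)))

  from-⊤ : from k N.⊤ M.≈ M.⊤
  from-⊤ = M.antisym (PM.x≤⊤ _) (to≤⇒≤from (PN.x≤⊤ _))

  conjugate : LinMap M → LinMap N
  conjugate f = record
    { fun = λ x → to k (fun f (from k x))
    ; adj = λ y → to k (adj f (from k y))
    ; fun-cong = λ e → to-cong k (fun-cong f (from-cong k e))
    ; adj-cong = λ e → to-cong k (adj-cong f (from-cong k e))
    ; adjoint = λ x y →
        (λ p → PN.≤-respʳ (to-ᗮ k _) (PN.≤-respˡ (to-from k x) (to-mono k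
                 (proj₁ (adjoint f (from k x) (from k y)) (PM.≤-respʳ (from-ᗮ y) (to≤⇒≤from p)))))) ,
        (λ p → ≤from⇒to≤ (PM.≤-respʳ (PM.E.sym (from-ᗮ y)) (proj₂ (adjoint f (from k x) (from k y))
                 (PM.≤-respʳ (from-to k _) (from-mono (PN.≤-respʳ (PN.E.sym (to-ᗮ k _)) p))))))
    }

  conjugate-injective : ∀ f g → (∀ x → fun (conjugate f) x N.≈ fun (conjugate g) x) →
                        ∀ y → fun f y M.≈ fun g y
  conjugate-injective f g conj-f≈conj-g y =
    PM.E.trans (fun-cong f (PM.E.sym (from-to k y)))
      (PM.E.trans (to-injective (conj-f≈conj-g (to k y))) (fun-cong g (from-to k y)))

  conjugate-sasaki : ∀ m x → to k (M.π m (from k x)) N.≈ N.π (to k m) x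
  conjugate-sasaki m x = PN.E.trans (to-π m _) (PN.π-cong _ (to-from k x))

  conjugate-isIDAMorphism : IsIDAMorphism (Lin M) (Lin N) conjugate
  conjugate-isIDAMorphism = record
    { cong = λ f≈g x → to-cong k (f≈g _)
    ; ⨆-hom = λ _ _ → to-sup _
    ; ⊙-hom = λ f _ _ → to-cong k (fun-cong f (PM.E.sym (from-to k _)))
    ; e-hom = to-from k
    ; *-hom = λ _ _ → PN.E.refl
    ; ∼-hom = λ f x → PN.E.trans (conjugate-sasaki _ x) (PN.π-congˡ x
        (PN.E.trans (to-ᗮ k _) (PN.ᗮ-cong (to-cong k (fun-cong f (PM.E.sym from-⊤))))))
    }

module PowersetIDA (T : TFunctor) {c ℓ ι : Level} (M : COML c ℓ (c ⊔ ℓ ⊔ ι)) where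
  open COML M
  open OMLProperties M
  open LinMapProperties M
  open SetoidReasoning setoid

  private
    ι₀ : Level
    ι₀ = c ⊔ ℓ ⊔ ι

    module L = PreIDA (Lin M)

  P : PreIDA (lsuc ι₀) ι₀ ι₀
  P = Γ₀ T {ι = ι} M

  module P = PreIDA P
  module PE = IsEquivalence P.isEquivalence

  P-setoid : Setoid (lsuc ι₀) ι₀
  P-setoid = record { isEquivalence = P.isEquivalence }

  Map : Set (c ⊔ ℓ)
  Map = El {ι = ι} M (𝒯 T (Lin M))

  _∘ₘ_ : Map → Map → Map
  (f , 𝒯f) ∘ₘ (g , 𝒯g) = f L.⊙ g , 𝒯-⊙ T (Lin M) (LinIsIDA.isIDA M) 𝒯f 𝒯g

  _*ₘ : Map → Map
  (f , 𝒯f) *ₘ = f L.* , 𝒯-* T (Lin M) (LinIsIDA.isIDA M) 𝒯f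

  idₘ : Map
  idₘ = L.e , 𝒯-e T (Lin M) (LinIsIDA.isIDA M)

  -- π m = ∼ (π (m ᗮ)) in Lin M, and 𝒯 contains every ∼-element.
  sasakiₘ : Carrier → Map
  sasakiₘ m = sasakiMap m , 𝒯-resp T (Lin M) (LinIsIDA.isIDA M) {L.∼ (sasakiMap (m ᗮ))}
                              (λ x → π-congˡ x ([πmᗮ⊤]ᗮ≈m m))
                              (𝒯-tilde T (Lin M) (LinIsIDA.isIDA M) (sasakiMap (m ᗮ)))

  ｛_｝ : LinMap M → P.Carrier
  ｛ f ｝ = singleton {ι = ι} M (𝒯 T (Lin M)) f

  ｛｝-cong : ∀ f g → (∀ x → fun f x ≈ fun g x) → ｛ f ｝ P.≈ ｛ g ｝
  ｛｝-cong f g f≈g = (λ _ (lift p) → lift λ x → E.trans (p x) (f≈g x))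
               , (λ _ (lift p) → lift λ x → E.trans (p x) (E.sym (f≈g x)))

  ｛π｝-cong : ∀ {m n} → m ≈ n → ｛ sasakiMap m ｝ P.≈ ｛ sasakiMap n ｝
  ｛π｝-cong {m} {n} m≈n = ｛｝-cong (sasakiMap m) (sasakiMap n) λ x → π-congˡ x m≈n

  _⊆_ : P.Carrier → P.Carrier → Set ι₀
  A ⊆ B = ∀ h → mem A h → mem B h

  joinMap : P.Carrier → Carrier → Carrier
  joinMap A x = sup {Σ Map (mem A)} (λ a → fun (proj₁ (proj₁ a)) x)

  image : P.Carrier → Carrier
  image A = joinMap A ⊤

  joinMap-upper : ∀ A (a : Map) → mem A a → ∀ x → fun (proj₁ a) x ≤ joinMap A x
  joinMap-upper A a a∈A x = sup-upper (λ (a : Σ Map (mem A)) → fun (proj₁ (proj₁ a)) x) (a , a∈A)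

  joinMap-least : ∀ A {x z} → (∀ (a : Map) → mem A a → fun (proj₁ a) x ≤ z) → joinMap A x ≤ z
  joinMap-least A p = sup-least _ λ (a , a∈A) → p a a∈A

  joinMap-mono : ∀ A B → A ⊆ B → ∀ x → joinMap A x ≤ joinMap B x
  joinMap-mono A B A⊆B x = joinMap-least A λ a a∈A → joinMap-upper B a (A⊆B a a∈A) x

  joinMap-cong : ∀ A B → A P.≈ B → ∀ x → joinMap A x ≈ joinMap B x
  joinMap-cong A B (A⊆B , B⊆A) x = antisym (joinMap-mono A B A⊆B x) (joinMap-mono B A B⊆A x)

  joinMap-congʳ : ∀ A {x y} → x ≈ y → joinMap A x ≈ joinMap A y
  joinMap-congʳ A x≈y = sup-cong λ (a , _) → fun-cong (proj₁ a) x≈y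

  joinMap-｛｝ : ∀ (f : Map) x → joinMap ｛ proj₁ f ｝ x ≈ fun (proj₁ f) x
  joinMap-｛｝ f x = antisym (joinMap-least ｛ proj₁ f ｝ λ _ (lift p) → reflexive (p x))
                             (joinMap-upper ｛ proj₁ f ｝ f (lift λ _ → E.refl) x)

  joinMap-⨆ : ∀ {I : Set ι₀} (G : I → P.Carrier) x →
              joinMap (P.⨆ G) x ≈ sup (λ i → joinMap (G i) x)
  joinMap-⨆ G x = antisym
    (joinMap-least (P.⨆ G) λ a (i , a∈Gi) → trans (joinMap-upper (G i) a a∈Gi x) (sup-upper _ i))
    (sup-least _ λ i → joinMap-mono (G i) (P.⨆ G) (λ a a∈Gi → i , a∈Gi) x)

  joinMap-⊙ : ∀ A B x → joinMap (A P.⊙ B) x ≈ joinMap A (joinMap B x)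
  joinMap-⊙ A B x = antisym
    (joinMap-least (A P.⊙ B) λ h (a , b , a∈A , b∈B , h≈ab) →
      ≤-respˡ (E.sym (h≈ab x)) (trans (fun-mono (proj₁ a) (joinMap-upper B b b∈B x))
                                      (joinMap-upper A a a∈A _)))
    (joinMap-least A λ a a∈A → ≤-respˡ (E.sym (fun-sup (proj₁ a) _)) (sup-least _ λ (b , b∈B) →
      joinMap-upper (A P.⊙ B) (a ∘ₘ b) (a , b , a∈A , b∈B , λ _ → E.refl) x))

  image-⊔ : ∀ A B → image (A P.⊔' B) ≈ (image A ∨ image B)
  image-⊔ A B = E.trans (joinMap-⨆ (pair ι₀ A B) ⊤)
                        (sup-pair (λ i → image (pair ι₀ A B i)) E.refl E.refl)

  image-sasaki : ∀ m → image ｛ sasakiMap m ｝ ≈ m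
  image-sasaki m = E.trans (joinMap-｛｝ (sasakiₘ m) ⊤) (π-⊤ m)

  image-∼ : ∀ A → image (P.∼ A) ≈ (image A ᗮ)
  image-∼ A = image-sasaki (image A ᗮ)

  ∼-cong-image : ∀ A B → image A ≈ image B → P.∼ A P.≈ P.∼ B
  ∼-cong-image A B e = ｛π｝-cong (ᗮ-cong e)

  ∼∼-sasaki : ∀ A → P.∼ (P.∼ A) P.≈ ｛ sasakiMap (image A) ｝
  ∼∼-sasaki A = ｛π｝-cong (E.trans (ᗮ-cong (image-∼ A)) (ᗮ-involutive _))

  image-∼∼ : ∀ A → image (P.∼ (P.∼ A)) ≈ image A
  image-∼∼ A = E.trans (joinMap-cong (P.∼ (P.∼ A)) ｛ sasakiMap (image A) ｝ (∼∼-sasaki A) ⊤)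
                       (image-sasaki (image A))

  tilde-sasaki : ∀ A → P.IsTilde A → A P.≈ ｛ sasakiMap (image A) ｝
  tilde-sasaki A (B , A≈∼B) = PE.trans {A} {P.∼ B} {｛ sasakiMap (image A) ｝} A≈∼B
    (｛π｝-cong (E.sym (E.trans (joinMap-cong A (P.∼ B) A≈∼B ⊤) (image-∼ B))))

  ⊆⇒≤ : ∀ {A B} → A ⊆ B → A P.≤ B
  ⊆⇒≤ A⊆B = (λ h → λ { (lift true , h∈A) → A⊆B h h∈A ; (lift false , h∈B) → h∈B })
          , (λ h h∈B → lift false , h∈B)

  ≤⇒⊆ : ∀ {A B} → A P.≤ B → A ⊆ B
  ≤⇒⊆ A≤B h h∈A = proj₁ A≤B h (lift true , h∈A)

  ⊙-cong : ∀ A A' B B' → A P.≈ A' → B P.≈ B' → (A P.⊙ B) P.≈ (A' P.⊙ B')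
  ⊙-cong _ _ _ _ A≈A' B≈B' =
    (λ h (a , b , a∈A , b∈B , h≈ab) → a , b , proj₁ A≈A' a a∈A , proj₁ B≈B' b b∈B , h≈ab) ,
    (λ h (a , b , a∈A , b∈B , h≈ab) → a , b , proj₂ A≈A' a a∈A , proj₂ B≈B' b b∈B , h≈ab)

  ⊙-assoc : ∀ A B C → ((A P.⊙ B) P.⊙ C) P.≈ (A P.⊙ (B P.⊙ C))
  ⊙-assoc A B C =
    (λ h (ab , c , (a , b , a∈A , b∈B , ab≈) , c∈C , h≈) →
       a , b ∘ₘ c , a∈A , (b , c , b∈B , c∈C , λ _ → E.refl) ,
       λ x → E.trans (h≈ x) (ab≈ _)) ,
    (λ h (a , bc , a∈A , (b , c , b∈B , c∈C , bc≈) , h≈) →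
       a ∘ₘ b , c , (a , b , a∈A , b∈B , λ _ → E.refl) , c∈C ,
       λ x → E.trans (h≈ x) (fun-cong (proj₁ a) (bc≈ x)))

  ⊙-identityˡ : ∀ A → (P.e P.⊙ A) P.≈ A
  ⊙-identityˡ A =
    (λ h (u , a , lift u≈id , a∈A , h≈) → closed A (λ x → E.sym (E.trans (h≈ x) (u≈id _))) a∈A) ,
    (λ h h∈A → idₘ , h , lift (λ _ → E.refl) , h∈A , λ _ → E.refl)

  ⊙-identityʳ : ∀ A → (A P.⊙ P.e) P.≈ A
  ⊙-identityʳ A =
    (λ h (a , u , a∈A , lift u≈id , h≈) →
       closed A (λ x → E.sym (E.trans (h≈ x) (fun-cong (proj₁ a) (u≈id x)))) a∈A) ,
    (λ h h∈A → h , idₘ , h∈A , lift (λ _ → E.refl) , λ _ → E.refl)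

  ⊙-distribˡ : ∀ A {I : Set ι₀} (G : I → P.Carrier) → (A P.⊙ P.⨆ G) P.≈ P.⨆ (λ i → A P.⊙ G i)
  ⊙-distribˡ A G =
    (λ h (a , b , a∈A , (i , b∈Gi) , h≈) → i , (a , b , a∈A , b∈Gi , h≈)) ,
    (λ h (i , (a , b , a∈A , b∈Gi , h≈)) → a , b , a∈A , (i , b∈Gi) , h≈)

  ⊙-distribʳ : ∀ A {I : Set ι₀} (G : I → P.Carrier) → (P.⨆ G P.⊙ A) P.≈ P.⨆ (λ i → G i P.⊙ A)
  ⊙-distribʳ A G =
    (λ h (b , a , (i , b∈Gi) , a∈A , h≈) → i , (b , a , b∈Gi , a∈A , h≈)) ,
    (λ h (i , (b , a , b∈Gi , a∈A , h≈)) → b , a , (i , b∈Gi) , a∈A , h≈)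

  *-cong : ∀ A B → A P.≈ B → (A P.*) P.≈ (B P.*)
  *-cong _ _ A≈B = (λ h (a , a∈A , h≈) → a , proj₁ A≈B a a∈A , h≈)
                 , (λ h (a , a∈B , h≈) → a , proj₂ A≈B a a∈B , h≈)

  *-involutive : ∀ A → ((A P.*) P.*) P.≈ A
  *-involutive A =
    (λ h (b , (a , a∈A , b≈a*) , h≈b*) →
       closed A (λ x → E.sym (E.trans (h≈b* x) (adj-unique (proj₁ b) (proj₁ a L.*) b≈a* x))) a∈A) ,
    (λ h h∈A → h *ₘ , (h , h∈A , λ _ → E.refl) , λ _ → E.refl)

  *-anti : ∀ A B → ((A P.⊙ B) P.*) P.≈ ((B P.*) P.⊙ (A P.*))
  *-anti A B =
    (λ h (c , (a , b , a∈A , b∈B , c≈ab) , h≈c*) →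
       b *ₘ , a *ₘ , (b , b∈B , λ _ → E.refl) , (a , a∈A , λ _ → E.refl) ,
       λ x → E.trans (h≈c* x) (adj-unique (proj₁ c) (proj₁ a L.⊙ proj₁ b) c≈ab x)) ,
    (λ h (b' , a' , (b , b∈B , b'≈b*) , (a , a∈A , a'≈a*) , h≈) →
       a ∘ₘ b , (a , b , a∈A , b∈B , λ _ → E.refl) ,
       λ x → E.trans (h≈ x) (E.trans (b'≈b* _) (adj-cong (proj₁ b) (a'≈a* x))))

  *-⨆ : ∀ {I : Set ι₀} (G : I → P.Carrier) → (P.⨆ G P.*) P.≈ P.⨆ (λ i → G i P.*)
  *-⨆ G = (λ h (a , (i , a∈Gi) , h≈) → i , (a , a∈Gi , h≈))
        , (λ h (i , (a , a∈Gi , h≈)) → a , (i , a∈Gi) , h≈)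

  ∼-self-adjoint : ∀ A → (P.∼ A P.*) P.≈ P.∼ A
  ∼-self-adjoint A =
    (λ h (a , lift a≈π , h≈) →
       lift λ x → E.trans (h≈ x) (adj-unique (proj₁ a) (sasakiMap _) a≈π x)) ,
    (λ h (lift h≈π) → h , lift h≈π ,
       λ x → E.trans (h≈π x) (E.sym (adj-unique (proj₁ h) (sasakiMap _) h≈π x)))

  image-ida₁ : ∀ A B → image (A P.⊙ P.∼ (P.∼ B)) ≈ image (A P.⊙ B)
  image-ida₁ A B = begin
    image (A P.⊙ P.∼ (P.∼ B))       ≈⟨ joinMap-⊙ A (P.∼ (P.∼ B)) ⊤ ⟩
    joinMap A (image (P.∼ (P.∼ B))) ≈⟨ joinMap-congʳ A (image-∼∼ B) ⟩
    joinMap A (image B)             ≈⟨ joinMap-⊙ A B ⊤ ⟨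
    image (A P.⊙ B)                 ∎

  image-ida₂ : ∀ {I : Set ι₀} (G : I → P.Carrier) →
               image (P.⨆ (λ i → P.∼ (P.∼ (G i)))) ≈ image (P.⨆ G)
  image-ida₂ G = begin
    image (P.⨆ (λ i → P.∼ (P.∼ (G i)))) ≈⟨ joinMap-⨆ (λ i → P.∼ (P.∼ (G i))) ⊤ ⟩
    sup (λ i → image (P.∼ (P.∼ (G i)))) ≈⟨ sup-cong (λ i → image-∼∼ (G i)) ⟩
    sup (λ i → image (G i))             ≈⟨ joinMap-⨆ G ⊤ ⟨
    image (P.⨆ G)                       ∎

  image-ida₄ : ∀ A B → image (P.∼ (P.∼ (P.∼ A) P.⊙ B))
                       ≈ image (P.∼ A P.⊔' P.∼ (P.∼ A P.⊔' B))
  image-ida₄ A B = begin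
    image (P.∼ (P.∼ (P.∼ A) P.⊙ B))                 ≈⟨ image-∼ (P.∼ (P.∼ A) P.⊙ B) ⟩
    image (P.∼ (P.∼ A) P.⊙ B) ᗮ                     ≈⟨ ᗮ-cong (joinMap-⊙ (P.∼ (P.∼ A)) B ⊤) ⟩
    joinMap (P.∼ (P.∼ A)) (image B) ᗮ               ≈⟨ ᗮ-cong (joinMap-｛｝ (sasakiₘ (image (P.∼ A) ᗮ)) _) ⟩
    π (image (P.∼ A) ᗮ) (image B) ᗮ                 ≈⟨ ᗮ-cong (π-congˡ _ (ᗮ-cong (image-∼ A))) ⟩
    π (image A ᗮ ᗮ) (image B) ᗮ                     ≈⟨ ᗮ-cong (π-congˡ _ (ᗮ-involutive _)) ⟩
    π (image A) (image B) ᗮ                         ≈⟨ ᗮ-cong ([mᗮ∨[mᗮ∨n]ᗮ]ᗮ≈πmn _ _) ⟨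
    ((image A ᗮ) ∨ (((image A ᗮ) ∨ image B) ᗮ)) ᗮ ᗮ ≈⟨ ᗮ-involutive _ ⟩
    (image A ᗮ) ∨ (((image A ᗮ) ∨ image B) ᗮ)       ≈⟨ ∨-cong (image-∼ A) ∼A⊔B ⟨
    image (P.∼ A) ∨ image (P.∼ (P.∼ A P.⊔' B))      ≈⟨ image-⊔ (P.∼ A) (P.∼ (P.∼ A P.⊔' B)) ⟨
    image (P.∼ A P.⊔' P.∼ (P.∼ A P.⊔' B))           ∎
    where
      ∼A⊔B : image (P.∼ (P.∼ A P.⊔' B)) ≈ (((image A ᗮ) ∨ image B) ᗮ)
      ∼A⊔B = E.trans (image-∼ (P.∼ A P.⊔' B))
                     (ᗮ-cong (E.trans (image-⊔ (P.∼ A) B) (∨-cong (image-∼ A) E.refl)))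

  isIDA : IsIDA P
  isIDA = record
    { isPartialOrder = record
        { isPreorder = record
            { isEquivalence = P.isEquivalence
            ; reflexive = λ A≈B → ⊆⇒≤ (proj₁ A≈B)
            ; trans = λ A≤B B≤C → ⊆⇒≤ λ h h∈A → ≤⇒⊆ B≤C h (≤⇒⊆ A≤B h h∈A) }
        ; antisym = λ A≤B B≤A → ≤⇒⊆ A≤B , ≤⇒⊆ B≤A }
    ; ⨆-upper = λ G i → ⊆⇒≤ λ h h∈Gi → i , h∈Gi
    ; ⨆-least = λ G Gi≤B → ⊆⇒≤ λ h (i , h∈Gi) → ≤⇒⊆ (Gi≤B i) h h∈Gi
    ; ⊙-cong = λ {A} {A'} {B} {B'} → ⊙-cong A A' B B'
    ; ⊙-assoc = ⊙-assoc
    ; ⊙-identityˡ = ⊙-identityˡ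
    ; ⊙-identityʳ = ⊙-identityʳ
    ; ⊙-distribˡ = ⊙-distribˡ
    ; ⊙-distribʳ = ⊙-distribʳ
    ; *-cong = λ {A} {B} → *-cong A B
    ; *-involutive = *-involutive
    ; *-anti = *-anti
    ; *-⨆ = *-⨆
    ; ∼-cong = λ {A} {B} A≈B → ∼-cong-image A B (joinMap-cong A B A≈B ⊤)
    ; ida₁ = λ A B → ∼-cong-image (A P.⊙ P.∼ (P.∼ B)) (A P.⊙ B) (image-ida₁ A B)
    ; ida₂ = λ G → ∼-cong-image (P.⨆ (λ i → P.∼ (P.∼ (G i)))) (P.⨆ G) (image-ida₂ G)
    ; ida₃ = ∼-self-adjoint
    ; ida₄ = λ A B → ∼-cong-image (P.∼ (P.∼ (P.∼ A) P.⊙ B)) (P.∼ A P.⊔' P.∼ (P.∼ A P.⊔' B))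
                                  (image-ida₄ A B)
    }

module PowersetTODA (T : TFunctor) {c ℓ ι : Level} (M : COML c ℓ (c ⊔ ℓ ⊔ ι)) where
  open COML M
  open OMLProperties M
  open LinMapProperties M using (sasakiMap)
  open PowersetIDA T {c} {ℓ} {ι} M

  private
    ι₀ : Level
    ι₀ = c ⊔ ℓ ⊔ ι

    module ≈-M = SetoidReasoning setoid
    module ≈-P = SetoidReasoning P-setoid

  sasakiTilde : Carrier → P.Tilde
  sasakiTilde m = ｛ sasakiMap m ｝ , ｛ sasakiMap (m ᗮ) ｝ ,
    ｛π｝-cong (E.sym (E.trans (ᗮ-cong (image-sasaki (m ᗮ))) (ᗮ-involutive m)))

  image-injectiveᵗ : ∀ (A B : P.Tilde) → image (proj₁ A) ≈ image (proj₁ B) → A P.≈ᵗ B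
  image-injectiveᵗ (A , A~) (B , B~) e = begin
    A                         ≈⟨ tilde-sasaki A A~ ⟩
    ｛ sasakiMap (image A) ｝ ≈⟨ ｛π｝-cong e ⟩
    ｛ sasakiMap (image B) ｝ ≈⟨ tilde-sasaki B B~ ⟨
    B                         ∎
    where open ≈-P

  image-monoᵗ : ∀ (A B : P.Tilde) → A P.⪯ᵗ B → image (proj₁ A) ≤ image (proj₁ B)
  image-monoᵗ (A , _) (B , _) A⪯B = ≤-respʳ A∨B≈B (∨-l (image A) (image B))
    where
      open ≈-M
      A∨B≈B : (image A ∨ image B) ≈ image B
      A∨B≈B = begin
        image A ∨ image B            ≈⟨ image-⊔ A B ⟨
        image (A P.⊔' B)             ≈⟨ image-∼∼ (A P.⊔' B) ⟨
        image (P.∼ (P.∼ (A P.⊔' B))) ≈⟨ joinMap-cong (P.∼ (P.∼ (A P.⊔' B))) B A⪯B ⊤ ⟩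
        image B                      ∎

  image-reflectᵗ : ∀ (A B : P.Tilde) → image (proj₁ A) ≤ image (proj₁ B) → A P.⪯ᵗ B
  image-reflectᵗ (A , _) (B , B~) A≤B = begin
    P.∼ (P.∼ (A P.⊔' B))               ≈⟨ ∼∼-sasaki (A P.⊔' B) ⟩
    ｛ sasakiMap (image (A P.⊔' B)) ｝ ≈⟨ ｛π｝-cong A⊔B≈B ⟩
    ｛ sasakiMap (image B) ｝          ≈⟨ tilde-sasaki B B~ ⟨
    B                                  ∎
    where
      open ≈-P
      A⊔B≈B : image (A P.⊔' B) ≈ image B
      A⊔B≈B = E.trans (image-⊔ A B) (antisym (∨-least A≤B refl) (∨-r _ _))

  semiFoulis : SemiFoulis P
  semiFoulis = TransportCOML.isCOML M P._≈ᵗ_ P._⪯ᵗ_ P._ᗮᵗ (λ A → image (proj₁ A)) sasakiTilde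
    image-sasaki (λ {A} {B} A≈B → joinMap-cong (proj₁ A) (proj₁ B) A≈B ⊤)
    (λ {A} {B} → image-injectiveᵗ A B) (λ {A} {B} → image-monoᵗ A B)
    (λ {A} {B} → image-reflectᵗ A B) (λ A → image-∼ (proj₁ A))

  private
    σ : Σ (LinMap M) (𝒯 T (Lin M)) → Σ P.Carrier (𝒯 T P)
    σ = proj₁ (T3 T {c} {ℓ} {ι} M)

    σ≈｛｝ : ∀ f → proj₁ (σ f) P.≈ ｛ proj₁ f ｝
    σ≈｛｝ = proj₁ (proj₂ (T3 T {c} {ℓ} {ι} M))

  𝒯-｛｝ : ∀ (f : Map) → 𝒯 T P ｛ proj₁ f ｝
  𝒯-｛｝ f = 𝒯-resp T P isIDA (σ≈｛｝ f) (proj₂ (σ f))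

  𝒯⇒｛｝ : ∀ A → 𝒯 T P A → Σ Map λ f → A P.≈ ｛ proj₁ f ｝
  𝒯⇒｛｝ A 𝒯A =
    let f , σf≈A = IsIMIso.surjective (proj₂ (proj₂ (T3 T {c} {ℓ} {ι} M))) (A , 𝒯A)
    in f , PE.trans {A} {proj₁ (σ f)} {｛ proj₁ f ｝} (PE.sym {proj₁ (σ f)} {A} σf≈A) (σ≈｛｝ f)

  ≈｛｝⇒∈ : ∀ A (f : Map) → A P.≈ ｛ proj₁ f ｝ → mem A f
  ≈｛｝⇒∈ A f (_ , ｛f｝⊆A) = ｛f｝⊆A f (lift λ _ → E.refl)

  ≈｛｝-cong : ∀ A B (f g : Map) → A P.≈ ｛ proj₁ f ｝ → B P.≈ ｛ proj₁ g ｝ →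
              (∀ x → fun (proj₁ f) x ≈ fun (proj₁ g) x) → A P.≈ B
  ≈｛｝-cong A B f g A≈f B≈g f≈g = begin
    A             ≈⟨ A≈f ⟩
    ｛ proj₁ f ｝ ≈⟨ ｛｝-cong (proj₁ f) (proj₁ g) f≈g ⟩
    ｛ proj₁ g ｝ ≈⟨ B≈g ⟨
    B             ∎
    where open ≈-P

  ⨆-｛｝ : ∀ A → P.⨆ (λ (a : Σ Map (mem A)) → ｛ proj₁ (proj₁ a) ｝) P.≈ A
  ⨆-｛｝ A = (λ h ((a , a∈A) , lift h≈a) → closed A (λ x → E.sym (h≈a x)) a∈A)
           , (λ h h∈A → (h , h∈A) , lift λ _ → E.refl)

  ⨆-𝒯-matching : ∀ {I J : Set ι₀} (s : I → P.Carrier) (t : J → P.Carrier) →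
                 (∀ i → 𝒯 T P (s i)) → (∀ j → 𝒯 T P (t j)) →
                 P.⨆ s ⊆ P.⨆ t → ∀ i → Σ J λ j → s i P.≈ t j
  ⨆-𝒯-matching s t 𝒯s 𝒯t s⊆t i =
    let f , si≈f = 𝒯⇒｛｝ (s i) (𝒯s i)
        j , f∈tj = s⊆t f (i , ≈｛｝⇒∈ (s i) f si≈f)
        g , tj≈g = 𝒯⇒｛｝ (t j) (𝒯t j)
    in j , ≈｛｝-cong (s i) (t j) f g si≈f tj≈g (lower (proj₁ tj≈g f f∈tj))

  image-•-sasaki : ∀ A (f : Map) → A P.≈ ｛ proj₁ f ｝ → ∀ x →
                   image (A P.• ｛ sasakiMap x ｝) ≈ fun (proj₁ f) x
  image-•-sasaki A f A≈f x = begin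
    image (A P.• ｛ sasakiMap x ｝)     ≈⟨ image-∼∼ (A P.⊙ ｛ sasakiMap x ｝) ⟩
    image (A P.⊙ ｛ sasakiMap x ｝)     ≈⟨ joinMap-⊙ A ｛ sasakiMap x ｝ ⊤ ⟩
    joinMap A (image ｛ sasakiMap x ｝) ≈⟨ joinMap-congʳ A (image-sasaki x) ⟩
    joinMap A x                         ≈⟨ joinMap-cong A ｛ proj₁ f ｝ A≈f x ⟩
    joinMap ｛ proj₁ f ｝ x             ≈⟨ joinMap-｛｝ f x ⟩
    fun (proj₁ f) x                     ∎
    where open ≈-M

  ≡ᵏ⇒≈ : ∀ A B → 𝒯 T P A → 𝒯 T P B → A P.≡ᵏ B → A P.≈ B
  ≡ᵏ⇒≈ A B 𝒯A 𝒯B A≡B =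
    let f , A≈f = 𝒯⇒｛｝ A 𝒯A
        g , B≈g = 𝒯⇒｛｝ B 𝒯B
    in ≈｛｝-cong A B f g A≈f B≈g λ x →
         E.trans (E.sym (image-•-sasaki A f A≈f x))
           (E.trans (joinMap-cong (A P.• ｛ sasakiMap x ｝) (B P.• ｛ sasakiMap x ｝)
                                  (A≡B ｛ sasakiMap x ｝ (proj₂ (sasakiTilde x))) ⊤)
                    (image-•-sasaki B g B≈g x))

  isTODA : IsTODA T P
  isTODA = record
    { isIDA = isIDA
    ; toda1 = semiFoulis
    ; toda2 = λ Pr Pr-resp Pr-𝒯 _ _ Pr-⨆ A →
        Pr-resp (⨆-｛｝ A) (Pr-⨆ _ λ (a , _) → Pr-𝒯 _ (𝒯-｛｝ a))
    ; toda3 = λ s t 𝒯s 𝒯t →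
        (λ (s⊆t , t⊆s) → ⨆-𝒯-matching s t 𝒯s 𝒯t s⊆t , ⨆-𝒯-matching t s 𝒯t 𝒯s t⊆s)
      , (λ (s⊆t , t⊆s) → IDAProperties.⨆-cong-matching isIDA s t s⊆t t⊆s)
    ; toda4 = λ A B 𝒯A 𝒯B → IDAProperties.≈⇒≡ᵏ isIDA {A} {B} , ≡ᵏ⇒≈ A B 𝒯A 𝒯B
    }

module ConjugationMorphism (T : TFunctor) {c ℓ ι : Level} {M N : COML c ℓ (c ⊔ ℓ ⊔ ι)}
                           (k : OIso M N) where
  private
    module M = COML M
    module N = COML N
    module PM = OMLProperties M
    module PN = OMLProperties N
    module ΓM = PowersetIDA T {c} {ℓ} {ι} M
    module ΓN = PowersetIDA T {c} {ℓ} {ι} N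
    module K = OIsoProperties k
    module K⁻¹ = OIsoProperties K.inverse
    module ≈-P = SetoidReasoning ΓN.P-setoid
    open LinMapProperties using (sasakiMap; adj-unique)

  Γk : ΓM.P.Carrier → ΓN.P.Carrier
  Γk = Γ₁ T {ι = ι} k

  conjugateₘ : ΓM.Map → ΓN.Map
  conjugateₘ (f , 𝒯f) =
    K.conjugate f , 𝒯-map T (Lin M) (Lin N) (LinIsIDA.isIDA M) (LinIsIDA.isIDA N)
                          K.conjugate K.conjugate-isIDAMorphism f 𝒯f

  unconjugateₘ : ΓN.Map → ΓM.Map
  unconjugateₘ (h , 𝒯h) =
    K⁻¹.conjugate h , 𝒯-map T (Lin N) (Lin M) (LinIsIDA.isIDA N) (LinIsIDA.isIDA M)
                            K⁻¹.conjugate K⁻¹.conjugate-isIDAMorphism h 𝒯h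

  conjugate-unconjugate : ∀ (h : ΓN.Map) x →
                          fun (proj₁ h) x N.≈ to k (fun (proj₁ (unconjugateₘ h)) (from k x))
  conjugate-unconjugate (h , _) x =
    PN.E.sym (PN.E.trans (to-from k _) (fun-cong h (to-from k x)))

  ∈-Γ : ∀ A (h : ΓN.Map) → mem A (unconjugateₘ h) → mem (Γk A) h
  ∈-Γ A h p = unconjugateₘ h , p , conjugate-unconjugate h

  Γ-｛｝ : ∀ f → Γk ΓM.｛ f ｝ ΓN.P.≈ ΓN.｛ K.conjugate f ｝
  Γ-｛｝ f =
    (λ h (a , lift a≈f , h≈) → lift λ x → PN.E.trans (h≈ x) (to-cong k (a≈f _))) ,
    (λ h (lift h≈f) → ∈-Γ ΓM.｛ f ｝ h (lift λ y →
       PM.E.trans (from-cong k (h≈f _)) (PM.E.trans (from-to k _) (fun-cong f (from-to k y)))))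

  image-Γ : ∀ A → ΓN.image (Γk A) N.≈ to k (ΓM.image A)
  image-Γ A = N.antisym
    (ΓN.joinMap-least (Γk A) λ h (a , a∈A , h≈) →
       PN.≤-respˡ (PN.E.sym (PN.E.trans (h≈ _) (to-cong k (fun-cong (proj₁ a) K.from-⊤))))
                  (to-mono k (ΓM.joinMap-upper A a a∈A M.⊤)))
    (PN.≤-respˡ (PN.E.sym (K.to-sup _)) (N.sup-least _ λ (a , a∈A) →
       PN.≤-respˡ (to-cong k (fun-cong (proj₁ a) K.from-⊤))
                  (ΓN.joinMap-upper (Γk A) (conjugateₘ a) (a , a∈A , λ _ → PN.E.refl) N.⊤)))

  Γ-e : Γk ΓM.P.e ΓN.P.≈ ΓN.P.e
  Γ-e = begin
    Γk ΓM.｛ idᴹ ｝          ≈⟨ Γ-｛｝ idᴹ ⟩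
    ΓN.｛ K.conjugate idᴹ ｝ ≈⟨ ΓN.｛｝-cong (K.conjugate idᴹ) idᴺ (to-from k) ⟩
    ΓN.｛ idᴺ ｝             ∎
    where
      open ≈-P
      idᴹ : LinMap M
      idᴹ = PreIDA.e (Lin M)
      idᴺ : LinMap N
      idᴺ = PreIDA.e (Lin N)

  Γ-⊙ : ∀ A B → Γk (A ΓM.P.⊙ B) ΓN.P.≈ (Γk A ΓN.P.⊙ Γk B)
  Γ-⊙ A B =
    (λ h (c , (a , b , a∈A , b∈B , c≈ab) , h≈) →
       conjugateₘ a , conjugateₘ b , (a , a∈A , λ _ → PN.E.refl) , (b , b∈B , λ _ → PN.E.refl) ,
       λ x → PN.E.trans (h≈ x) (PN.E.trans (to-cong k (c≈ab _))
               (to-cong k (fun-cong (proj₁ a) (PM.E.sym (from-to k _)))))) ,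
    (λ h (a' , b' , (a , a∈A , a'≈) , (b , b∈B , b'≈) , h≈) →
       a ΓM.∘ₘ b , (a , b , a∈A , b∈B , λ _ → PM.E.refl) ,
       λ x → PN.E.trans (h≈ x) (PN.E.trans (a'≈ _) (to-cong k (fun-cong (proj₁ a)
               (PM.E.trans (from-cong k (b'≈ x)) (from-to k _))))))

  Γ-* : ∀ A → Γk (A ΓM.P.*) ΓN.P.≈ (Γk A ΓN.P.*)
  Γ-* A =
    (λ h (b , (a , a∈A , b≈a*) , h≈) →
       conjugateₘ a , (a , a∈A , λ _ → PN.E.refl) , λ x → PN.E.trans (h≈ x) (to-cong k (b≈a* _))) ,
    (λ h (c , (a , a∈A , c≈) , h≈) →
       a ΓM.*ₘ , (a , a∈A , λ _ → PM.E.refl) ,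
       λ x → PN.E.trans (h≈ x) (adj-unique N (proj₁ c) (K.conjugate (proj₁ a)) c≈ x))

  Γ-∼ : ∀ A → Γk (ΓM.P.∼ A) ΓN.P.≈ ΓN.P.∼ (Γk A)
  Γ-∼ A = begin
    Γk (ΓM.P.∼ A)           ≈⟨ Γ-｛｝ πₘ ⟩
    ΓN.｛ K.conjugate πₘ ｝ ≈⟨ ΓN.｛｝-cong (K.conjugate πₘ) πₙ conjugate-π ⟩
    ΓN.P.∼ (Γk A)           ∎
    where
      open ≈-P
      πₘ : LinMap M
      πₘ = sasakiMap M (ΓM.image A M.ᗮ)
      πₙ : LinMap N
      πₙ = sasakiMap N (ΓN.image (Γk A) N.ᗮ)
      conjugate-π : ∀ x → to k (M.π (ΓM.image A M.ᗮ) (from k x)) N.≈ N.π (ΓN.image (Γk A) N.ᗮ) x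
      conjugate-π x = PN.E.trans (K.conjugate-sasaki _ x)
        (PN.π-congˡ x (PN.E.trans (to-ᗮ k _) (PN.ᗮ-cong (PN.E.sym (image-Γ A)))))

  isIDAMorphism : IsIDAMorphism ΓM.P ΓN.P Γk
  isIDAMorphism = record
    { cong = λ A≈B → (λ h (a , a∈A , h≈) → a , proj₁ A≈B a a∈A , h≈)
                   , (λ h (a , a∈B , h≈) → a , proj₂ A≈B a a∈B , h≈)
    ; ⨆-hom = λ G → (λ h (a , (i , a∈Gi) , h≈) → i , (a , a∈Gi , h≈))
                  , (λ h (i , (a , a∈Gi , h≈)) → a , (i , a∈Gi) , h≈)
    ; ⊙-hom = Γ-⊙
    ; e-hom = Γ-e
    ; *-hom = Γ-*
    ; ∼-hom = Γ-∼
    }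

  Γ-reflects-⊆ : ∀ A B → Γk A ΓN.⊆ Γk B → A ΓM.⊆ B
  Γ-reflects-⊆ A B ΓA⊆ΓB a a∈A =
    let b , b∈B , conj-a≈conj-b = ΓA⊆ΓB (conjugateₘ a) (a , a∈A , λ _ → PN.E.refl)
    in closed B (PM.E.sym ∘ K.conjugate-injective (proj₁ a) (proj₁ b) conj-a≈conj-b) b∈B

  bijective : Bijective ΓM.P ΓN.P Γk
  bijective = record
    { injective = λ A B (ΓA⊆ΓB , ΓB⊆ΓA) → Γ-reflects-⊆ A B ΓA⊆ΓB , Γ-reflects-⊆ B A ΓB⊆ΓA
    ; surjective = λ B → preimage B ,
        (λ h (a , conj-a∈B , h≈) → closed B (λ x → PN.E.sym (h≈ x)) conj-a∈B) ,
        (λ h h∈B → ∈-Γ (preimage B) h (closed B (conjugate-unconjugate h) h∈B))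
    }
    where
      preimage : ΓN.P.Carrier → ΓM.P.Carrier
      preimage B = record { mem = λ a → mem B (conjugateₘ a)
                          ; closed = λ a≈b → closed B (λ x → to-cong k (a≈b _)) }

module FunctorLaws (T : TFunctor) {c ℓ ι : Level} where

  Γ₁-identity : (M : COML c ℓ (c ⊔ ℓ ⊔ ι)) (A : Sub {ι = ι} M (𝒯 T (Lin M))) →
                PreIDA._≈_ (Γ₀ T {ι = ι} M) (Γ₁ T {ι = ι} (idOIso M) A) A
  Γ₁-identity M A = (λ h (a , a∈A , h≈a) → closed A (λ x → E.sym (h≈a x)) a∈A)
                  , (λ h h∈A → h , h∈A , λ _ → E.refl)
    where module E = IsEquivalence (COML.isEquivalence M)

  Γ₁-∘ : (M N O : COML c ℓ (c ⊔ ℓ ⊔ ι)) (k : OIso M N) (k' : OIso N O)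
         (A : Sub {ι = ι} M (𝒯 T (Lin M))) →
         PreIDA._≈_ (Γ₀ T {ι = ι} O) (Γ₁ T {ι = ι} (k' ∘ᴼ k) A)
                    (Γ₁ T {ι = ι} k' (Γ₁ T {ι = ι} k A))
  Γ₁-∘ M N O k k' A =
    (λ h (a , a∈A , h≈) →
       ConjugationMorphism.conjugateₘ T {c} {ℓ} {ι} k a , (a , a∈A , λ _ → EN.refl) , h≈) ,
    (λ h (b , (a , a∈A , b≈) , h≈) → a , a∈A , λ x → EO.trans (h≈ x) (to-cong k' (b≈ _)))
    where module EN = IsEquivalence (COML.isEquivalence N)
          module EO = IsEquivalence (COML.isEquivalence O)

theorem5p5 : (T : TFunctor) {c ℓ ι : Level} →
    ((M : COML c ℓ (c ⊔ ℓ ⊔ ι)) → IsTODA T (Γ₀ T {ι = ι} M))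
    × ((M N : COML c ℓ (c ⊔ ℓ ⊔ ι)) (k : OIso M N) →
         IsIDAMorphism (Γ₀ T {ι = ι} M) (Γ₀ T {ι = ι} N) (Γ₁ T {ι = ι} k)
       × Bijective (Γ₀ T {ι = ι} M) (Γ₀ T {ι = ι} N) (Γ₁ T {ι = ι} k))
    × ((M : COML c ℓ (c ⊔ ℓ ⊔ ι)) (A : Sub {ι = ι} M (𝒯 T (Lin M))) →
         PreIDA._≈_ (Γ₀ T {ι = ι} M) (Γ₁ T {ι = ι} (idOIso M) A) A)
    × ((M N O : COML c ℓ (c ⊔ ℓ ⊔ ι)) (k : OIso M N) (k' : OIso N O)
       (A : Sub {ι = ι} M (𝒯 T (Lin M))) →
         PreIDA._≈_ (Γ₀ T {ι = ι} O) (Γ₁ T {ι = ι} (k' ∘ᴼ k) A)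
                    (Γ₁ T {ι = ι} k' (Γ₁ T {ι = ι} k A)))
theorem5p5 T {c} {ℓ} {ι} =
    (λ M → PowersetTODA.isTODA T {c} {ℓ} {ι} M)
  , (λ M N k → ConjugationMorphism.isIDAMorphism T {c} {ℓ} {ι} k
             , ConjugationMorphism.bijective T {c} {ℓ} {ι} k)
  , FunctorLaws.Γ₁-identity T {c} {ℓ} {ι}
  , FunctorLaws.Γ₁-∘ T {c} {ℓ} {ι}
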